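{- Let $r\geq1$ and $l\geq 1$ be integers. If $H$ is an $r$-hypergraph with $n$ vertices and $q\geq 1$ edges, having at least $r^{l-1}+1$ distinct $r$-partitions, then there exists an $r$-partite $r$-hypergraph with $n-l$ vertices and $q$ edges.
   Context: A hypergraph is a pair $(V,\mathbb E)$ with $V$ a finite vertex set and $\mathbb E$ a set of non-empty subsets of $V$ (edges); it is an $r$-hypergraph if every edge has exactly $r$ elements. An $r$-partition of an $r$-hypergraph is a partition of its vertex set such that every edge is a transversal (contains exactly one point of each block). An $r$-hypergraph is $r$-partite if it has an $r$-partition. -}

module Defs where

open import Data.Nat using (ℕ; suc; _^_; _∸_; _≥_)
open import Data.Fin using (Fin)
open import Data.Fin.Subset using (Subset; _∈_; _∩_; ∣_∣; Nonempty)
open import Data.List using (List; length)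
open import Data.List.Relation.Unary.Unique.Propositional using (Unique)
open import Data.List.Relation.Unary.AllPairs using (AllPairs)
open import Data.List.Relation.Unary.All using (All)
import Data.List.Membership.Propositional as LM
open import Data.Product using (Σ; ∃; _×_; _,_)
open import Relation.Binary.PropositionalEquality using (_≡_)
open import Relation.Nullary using (¬_)
open import Function.Bundles using (_⇔_)

record Hypergraph (n : ℕ) : Set where
  field
    edges    : List (Subset n)
    distinct : Unique edges
    nonempty : All Nonempty edges
open Hypergraph public

numEdges : ∀ {n} → Hypergraph n → ℕ
numEdges H = length (edges H)

IsUniform : ∀ {n} → ℕ → Hypergraph n → Set
IsUniform r H = All (λ e → ∣ e ∣ ≡ r) (edges H)

-- A partition of Fin n, given as a list of blocks (read as the SET of
-- its blocks): blocks are non-empty, cover Fin n, and are pairwise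
-- disjoint (two blocks sharing a point are equal).
IsPartition : ∀ {n} → List (Subset n) → Set
IsPartition {n} P =
  (∀ B → B LM.∈ P → Nonempty B) ×
  (∀ (x : Fin n) → ∃ λ B → B LM.∈ P × x ∈ B) ×
  (∀ B B′ (x : Fin n) → B LM.∈ P → B′ LM.∈ P → x ∈ B → x ∈ B′ → B ≡ B′)

IsRPartition : ∀ {n} → Hypergraph n → List (Subset n) → Set
IsRPartition H P =
  IsPartition P × (∀ e B → e LM.∈ edges H → B LM.∈ P → ∣ e ∩ B ∣ ≡ 1)

SamePartition : ∀ {n} → List (Subset n) → List (Subset n) → Set
SamePartition P P′ = ∀ B → (B LM.∈ P) ⇔ (B LM.∈ P′)

IsRPartite : ∀ {n} → Hypergraph n → Set
IsRPartite H = ∃ λ P → IsRPartition H P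

HasAtLeastRPartitions : ∀ {n} → ℕ → Hypergraph n → Set
HasAtLeastRPartitions {n} k H =
  ∃ λ (Ps : List (List (Subset n))) →
    length Ps ≡ k × All (IsRPartition H) Ps ×
    AllPairs (λ P P′ → ¬ SamePartition P P′) Ps

-- Fix an edge e₀ and enumerate it as v₀, …, v_{r−1}.  An r-partition is then the same as a colouring
-- χ : V → Fin r with χ(v_c) = c in which every edge is a transversal (meets every colour exactly once),
-- and distinct r-partitions give distinct colourings.  Given more than r·m such colourings, two of them
-- differ at some vertex x, which therefore lies off e₀, and by pigeonhole more than m of them give x the
-- same colour c.  Identify x with v_c: these colourings still make every contracted edge a transversal
-- and stay distinct, and no two edges collapse, because a colouring giving x and v_c the same colour
-- forbids an edge containing both, while two colourings agreeing at v_c but not at x forbid an edge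
-- containing x to become equal to one containing v_c.  Starting from r^(l−1) + 1 partitions, l such
-- contractions leave a colouring of a hypergraph on n − l vertices, whose colour classes form an r-partition.
module Submission where

open import Defs
open import Data.Nat using (ℕ; zero; suc; _+_; _*_; _^_; _∸_; _≤_; _<_; _≥_; z≤n; s≤s; _<?_; >-nonZero)
open import Data.Nat.Properties
  using (≤-refl; ≤-reflexive; ≤-antisym; ≤-trans; +-mono-≤; ≮⇒≥; <⇒≱; *-zeroʳ; m^n>0)
  using (+-0-commutativeMonoid)
open import Data.Fin using (Fin; zero; suc; punchIn; punchOut; fromℕ<)
open import Data.Fin.Properties
  using (any?; ¬∀⟶∃¬; suc-injective; injective⇒≤; punchIn-punchOut; punchInᵢ≢i; punchIn-injective)
  renaming (_≟_ to _≟ᶠ_)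
open import Data.Fin.Subset using (Subset; inside; outside; _∈_; _∉_; _∩_; _⊆_; ∣_∣; Nonempty)
open import Data.Fin.Subset.Properties using (_∈?_; x∈p∩q⁺; x∈p∩q⁻; ⊆-antisym)
open import Data.Vec using ([]; _∷_; here; there; tabulate)
open import Data.Vec.Properties using (tabulate-cong; lookup∘tabulate; []=⇒lookup; lookup⇒[]=)
open import Data.Vec.Functional using (removeAt)
open import Data.List using (List; []; _∷_; length; filter; map; allFin)
open import Data.List.Properties using (filter-accept; filter-reject; length-map)
open import Data.List.Relation.Unary.All as All using (All; []; _∷_)
import Data.List.Relation.Unary.All.Properties as All
open import Data.List.Relation.Unary.AllPairs using (AllPairs; []; _∷_)
import Data.List.Relation.Unary.AllPairs.Properties as AllPairs
open import Data.List.Relation.Unary.Any as Any using ()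
open import Data.List.Relation.Unary.Unique.Propositional using (Unique)
import Data.List.Membership.Propositional as List
open import Data.List.Membership.Propositional.Properties using (∈-map⁺; ∈-map⁻; ∈-allFin)
open import Data.Empty using (⊥; ⊥-elim)
open import Data.Product as Product using (Σ; ∃; _×_; _,_; proj₁; proj₂)
open import Data.Sum using (_⊎_; inj₁; inj₂; [_,_]′)
open import Function using (_∘_; id; Injective; mk⇔)
open import Relation.Binary.PropositionalEquality
open import Relation.Nullary using (¬_; yes; no; does; contradiction)
open import Relation.Nullary.Decidable using (dec-true; _⊎-dec_; _×-dec_)
open import Relation.Unary using (Pred; Decidable)
open import Algebra.Properties.CommutativeMonoid.Sum +-0-commutativeMonoid
  using (sum; sum-remove; sum-cong-≗; sum-replicate-zero)

private variable
  n m m′ r : ℕ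

0<length⇒∈ : ∀ {A : Set} {xs : List A} → 0 < length xs → ∃ λ a → a List.∈ xs
0<length⇒∈ {xs = x ∷ _} _ = x , Any.here refl

module _ {A B : Set} where

  AllPairs-map⁺-within : ∀ {P : A → Set} {R : A → A → Set} {S : B → B → Set} {f : A → B} →
                         (∀ {a b} → P a → P b → R a b → S (f a) (f b)) →
                         ∀ {xs} → All P xs → AllPairs R xs → AllPairs S (map f xs)
  AllPairs-map⁺-within preserve [] [] = []
  AllPairs-map⁺-within preserve (pa ∷ ps) (ras ∷ rs) =
    All.map⁺ (All.zipWith (λ (pb , rab) → preserve pa pb rab) (ps , ras)) ∷ AllPairs-map⁺-within preserve ps rs

  module _ {P : A → Set} (f : ∀ {a} → P a → B) where

    length-reduce : ∀ {xs} (ps : All P xs) → length (All.reduce f ps) ≡ length xs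
    length-reduce [] = refl
    length-reduce (_ ∷ ps) = cong suc (length-reduce ps)

    All-reduce⁺ : ∀ {Q : B → Set} → (∀ {a} (pa : P a) → Q (f pa)) →
                  ∀ {xs} (ps : All P xs) → All Q (All.reduce f ps)
    All-reduce⁺ good [] = []
    All-reduce⁺ good (pa ∷ ps) = good pa ∷ All-reduce⁺ good ps

    AllPairs-reduce⁺ : ∀ {R : A → A → Set} {S : B → B → Set} →
                       (∀ {a b} (pa : P a) (pb : P b) → R a b → S (f pa) (f pb)) →
                       ∀ {xs} (ps : All P xs) → AllPairs R xs → AllPairs S (All.reduce f ps)
    AllPairs-reduce⁺ preserve [] [] = []
    AllPairs-reduce⁺ {R} {S} preserve {a ∷ _} (pa ∷ ps) (ras ∷ rs) =
      related ps ras ∷ AllPairs-reduce⁺ preserve ps rs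
      where
      related : ∀ {ys} (qs : All P ys) → All (R a) ys → All (S (f pa)) (All.reduce f qs)
      related [] [] = []
      related (pb ∷ qs) (rab ∷ rs′) = preserve pa pb rab ∷ related qs rs′

fromDec : ∀ {ℓ} {P : Pred (Fin n) ℓ} → Decidable P → Subset n
fromDec P? = tabulate (does ∘ P?)

module _ {ℓ} {P : Pred (Fin n) ℓ} (P? : Decidable P) {i : Fin n} where

  ∈-fromDec⁺ : P i → i ∈ fromDec P?
  ∈-fromDec⁺ Pi = lookup⇒[]= i _ (trans (lookup∘tabulate _ i) (dec-true (P? i) Pi))

  ∈-fromDec⁻ : i ∈ fromDec P? → P i
  ∈-fromDec⁻ i∈ with P? i | trans (sym (lookup∘tabulate (does ∘ P?) i)) ([]=⇒lookup i∈)
  ... | yes Pi | _ = Pi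
  ... | no _   | ()

record Enumeration (p : Subset n) (m : ℕ) : Set where
  field
    point           : Fin m → Fin n
    point-∈         : ∀ k → point k ∈ p
    point-injective : Injective _≡_ _≡_ point
    point-onto      : ∀ {i} → i ∈ p → ∃ λ k → point k ≡ i

enumeration : (p : Subset n) → Enumeration p ∣ p ∣
enumeration [] = record
  { point = λ () ; point-∈ = λ () ; point-injective = λ {} ; point-onto = λ () }
enumeration (outside ∷ p) = record
  { point           = suc ∘ point
  ; point-∈         = there ∘ point-∈
  ; point-injective = point-injective ∘ suc-injective
  ; point-onto      = λ { (there i∈p) → Product.map₂ (cong suc) (point-onto i∈p) }
  }
  where open Enumeration (enumeration p)
enumeration (inside ∷ p) = record
  { point           = λ { zero → zero ; (suc k) → suc (point k) }
  ; point-∈         = λ { zero → here ; (suc k) → there (point-∈ k) }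
  ; point-injective = λ { {zero} {zero} _ → refl
                        ; {suc k} {suc k′} eq → cong suc (point-injective (suc-injective eq)) }
  ; point-onto      = λ { here → zero , refl
                        ; (there i∈p) → Product.map suc (cong suc) (point-onto i∈p) }
  }
  where open Enumeration (enumeration p)

enumeration-≤ : {p : Subset n} → Enumeration p m → Enumeration p m′ → m ≤ m′
enumeration-≤ E E′ = injective⇒≤ {f = index} λ {k} {l} eq →
  E.point-injective (trans (sym (index-point k)) (trans (cong E′.point eq) (index-point l)))
  where
  module E = Enumeration E
  module E′ = Enumeration E′
  index : Fin _ → Fin _
  index k = proj₁ (E′.point-onto (E.point-∈ k))
  index-point : ∀ k → E′.point (index k) ≡ E.point k
  index-point k = proj₂ (E′.point-onto (E.point-∈ k))

enumeration⇒∣p∣≡ : {p : Subset n} → Enumeration p m → ∣ p ∣ ≡ m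
enumeration⇒∣p∣≡ {p = p} E = ≤-antisym (enumeration-≤ (enumeration p) E) (enumeration-≤ E (enumeration p))

∃!⇒∣p∣≡1 : ∀ {p : Subset n} {i} → i ∈ p → (∀ {j} → j ∈ p → j ≡ i) → ∣ p ∣ ≡ 1
∃!⇒∣p∣≡1 {i = i} i∈p unique = enumeration⇒∣p∣≡ (record
  { point           = λ _ → i
  ; point-∈         = λ _ → i∈p
  ; point-injective = λ { {zero} {zero} _ → refl }
  ; point-onto      = λ j∈p → zero , sym (unique j∈p)
  })

∣p∣≡1⇒∃! : ∀ {p : Subset n} → ∣ p ∣ ≡ 1 → ∃ λ i → i ∈ p × (∀ {j} → j ∈ p → j ≡ i)
∣p∣≡1⇒∃! {p = p} ∣p∣≡1 = point zero , point-∈ zero , unique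
  where
  open Enumeration (subst (Enumeration p) ∣p∣≡1 (enumeration p))
  unique : ∀ {j} → j ∈ p → j ≡ point zero
  unique j∈p with point-onto j∈p
  ... | zero , refl = refl

-- Pigeonhole

module _ {A : Set} where

  class : (A → Fin r) → Fin r → List A → List A
  class g c = filter (λ a → g a ≟ᶠ c)

  length≡∑-class : (g : A → Fin r) → ∀ xs → length xs ≡ sum (λ c → length (class g c xs))
  length≡∑-class {r} g [] = sym (sum-replicate-zero r)
  length≡∑-class {zero} g (a ∷ xs) with () ← g a
  length≡∑-class {suc _} g (a ∷ xs) = begin
    suc (length xs)                                ≡⟨ cong suc (length≡∑-class g xs) ⟩
    suc (sum sizes)                                ≡⟨ cong suc (sum-remove sizes) ⟩
    suc (sizes (g a) + sum (removeAt sizes (g a))) ≡⟨ cong₂ _+_ new-class-grows other-classes-unchanged ⟨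
    sizes′ (g a) + sum (removeAt sizes′ (g a))      ≡⟨ sum-remove sizes′ ⟨
    sum sizes′                                     ∎
    where
    open ≡-Reasoning
    sizes sizes′ : Fin _ → ℕ
    sizes c = length (class g c xs)
    sizes′ c = length (class g c (a ∷ xs))
    new-class-grows : sizes′ (g a) ≡ suc (sizes (g a))
    new-class-grows = cong length (filter-accept (λ b → g b ≟ᶠ g a) refl)
    other-classes-unchanged : sum (removeAt sizes′ (g a)) ≡ sum (removeAt sizes (g a))
    other-classes-unchanged = sum-cong-≗ λ j →
      cong length (filter-reject (λ b → g b ≟ᶠ punchIn (g a) j) (punchInᵢ≢i (g a) j ∘ sym))

sum-≤-* : (f : Fin n → ℕ) → (∀ i → f i ≤ m) → sum f ≤ n * m
sum-≤-* {zero}  f bounded = z≤n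
sum-≤-* {suc n} f bounded = +-mono-≤ (bounded zero) (sum-≤-* (f ∘ suc) (bounded ∘ suc))

pigeonhole-class : ∀ {A : Set} (g : A → Fin r) xs → r * m < length xs → ∃ λ c → m < length (class g c xs)
pigeonhole-class {r} {m} g xs r*m<∣xs∣ with any? (λ c → m <? length (class g c xs))
... | yes large = large
... | no ¬large = contradiction
  (≤-trans (≤-reflexive (length≡∑-class g xs)) (sum-≤-* _ λ c → ≮⇒≥ (¬large ∘ (c ,_))))
  (<⇒≱ r*m<∣xs∣)

-- Colourings in which every edge is a transversal

record Transversal (χ : Fin n → Fin r) (e : Subset n) : Set where
  field
    hit       : ∀ c → ∃ λ i → i ∈ e × χ i ≡ c
    injective : ∀ {i j} → i ∈ e → j ∈ e → χ i ≡ χ j → i ≡ j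

  point : Fin r → Fin n
  point c = proj₁ (hit c)

  point-∈ : ∀ c → point c ∈ e
  point-∈ c = proj₁ (proj₂ (hit c))

  colour-point : ∀ c → χ (point c) ≡ c
  colour-point c = proj₂ (proj₂ (hit c))

fibre : (Fin n → Fin r) → Fin r → Subset n
fibre χ c = fromDec (λ i → χ i ≟ᶠ c)

module _ (χ : Fin n → Fin r) {c : Fin r} {i : Fin n} where

  ∈-fibre⁺ : χ i ≡ c → i ∈ fibre χ c
  ∈-fibre⁺ = ∈-fromDec⁺ (λ j → χ j ≟ᶠ c)

  ∈-fibre⁻ : i ∈ fibre χ c → χ i ≡ c
  ∈-fibre⁻ = ∈-fromDec⁻ (λ j → χ j ≟ᶠ c)

fibre-cong : ∀ {χ ψ : Fin n → Fin r} {c} → χ ≗ ψ → fibre χ c ≡ fibre ψ c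
fibre-cong {c = c} χ≗ψ = tabulate-cong λ i → cong (λ d → does (d ≟ᶠ c)) (χ≗ψ i)

fibres : (Fin n → Fin r) → List (Subset n)
fibres χ = map (fibre χ) (allFin _)

module _ {χ : Fin n → Fin r} {e : Subset n} (T : Transversal χ e) where
  open Transversal T

  transversal-enumeration : Enumeration e r
  transversal-enumeration = record
    { point           = point
    ; point-∈         = point-∈
    ; point-injective = λ {c} {d} eq → trans (sym (colour-point c)) (trans (cong χ eq) (colour-point d))
    ; point-onto      = λ {i} i∈e → χ i , injective (point-∈ (χ i)) i∈e (colour-point (χ i))
    }

  transversal-∣e∣≡r : ∣ e ∣ ≡ r
  transversal-∣e∣≡r = enumeration⇒∣p∣≡ transversal-enumeration

  ∣e∩fibre∣≡1 : ∀ c → ∣ e ∩ fibre χ c ∣ ≡ 1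
  ∣e∩fibre∣≡1 c = ∃!⇒∣p∣≡1 (x∈p∩q⁺ (point-∈ c , ∈-fibre⁺ χ (colour-point c))) λ j∈ →
    let (j∈e , j∈fibre) = x∈p∩q⁻ e _ j∈ in
    injective j∈e (point-∈ c) (trans (∈-fibre⁻ χ j∈fibre) (sym (colour-point c)))

module _ (χ : Fin n → Fin r) where

  ∈-fibres⁻ : ∀ {B} → B List.∈ fibres χ → ∃ λ c → B ≡ fibre χ c
  ∈-fibres⁻ B∈ = let (c , _ , B≡) = ∈-map⁻ (fibre χ) B∈ in c , B≡

  fibre∈fibres : ∀ c → fibre χ c List.∈ fibres χ
  fibre∈fibres c = ∈-map⁺ (fibre χ) (∈-allFin c)

  fibres-isPartition : (∀ c → ∃ λ i → χ i ≡ c) → IsPartition (fibres χ)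
  fibres-isPartition surjective = inhabited , covering , disjoint
    where
    inhabited : ∀ B → B List.∈ fibres χ → Nonempty B
    inhabited B B∈ with ∈-fibres⁻ B∈
    ... | c , refl = Product.map₂ (∈-fibre⁺ χ) (surjective c)
    covering : ∀ i → ∃ λ B → B List.∈ fibres χ × i ∈ B
    covering i = fibre χ (χ i) , fibre∈fibres (χ i) , ∈-fibre⁺ χ refl
    disjoint : ∀ B B′ i → B List.∈ fibres χ → B′ List.∈ fibres χ → i ∈ B → i ∈ B′ → B ≡ B′
    disjoint B B′ i B∈ B′∈ i∈B i∈B′ with ∈-fibres⁻ B∈ | ∈-fibres⁻ B′∈
    ... | c , refl | c′ , refl = cong (fibre χ) (trans (sym (∈-fibre⁻ χ i∈B)) (∈-fibre⁻ χ i∈B′))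

  fibres-isRPartition : (∀ c → ∃ λ i → χ i ≡ c) → (H : Hypergraph n) → All (Transversal χ) (edges H) →
                        IsRPartition H (fibres χ)
  fibres-isRPartition surjective H transversals = fibres-isPartition surjective , λ e B e∈ B∈ →
    let (c , B≡) = ∈-fibres⁻ B∈ in
    trans (cong (λ B → ∣ e ∩ B ∣) B≡) (∣e∩fibre∣≡1 (All.lookup transversals e∈) c)

-- Labelling each block of an r-partition by the point v c of the fixed edge that it contains makes
-- r-partitions the same as admissible colourings.

Anchored : (Fin r → Fin n) → (Fin n → Fin r) → Set
Anchored v χ = ∀ c → χ (v c) ≡ c

Admissible : (Fin r → Fin n) → List (Subset n) → (Fin n → Fin r) → Set
Admissible v es χ = Anchored v χ × All (Transversal χ) es

module PartitionColouring (H : Hypergraph n) {e₀ : Subset n} (e₀∈H : e₀ List.∈ edges H)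
                          (E : Enumeration e₀ r) {P : List (Subset n)} (isRPartition : IsRPartition H P) where

  open Enumeration E renaming (point to v)

  private
    covering = proj₁ (proj₂ (proj₁ isRPartition))
    disjoint = proj₂ (proj₂ (proj₁ isRPartition))

  meets-once : ∀ {e C} → e List.∈ edges H → C List.∈ P →
               ∃ λ i → i ∈ e ∩ C × (∀ {j} → j ∈ e ∩ C → j ≡ i)
  meets-once e∈H C∈P = ∣p∣≡1⇒∃! (proj₂ isRPartition _ _ e∈H C∈P)

  block : Fin n → Subset n
  block i = proj₁ (covering i)

  block∈P : ∀ i → block i List.∈ P
  block∈P i = proj₁ (proj₂ (covering i))

  ∈-block : ∀ i → i ∈ block i
  ∈-block i = proj₂ (proj₂ (covering i))

  block-unique : ∀ {C i} → C List.∈ P → i ∈ C → block i ≡ C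
  block-unique C∈P i∈C = disjoint _ _ _ (block∈P _) C∈P (∈-block _) i∈C

  anchors-separated : ∀ {C c d} → C List.∈ P → v c ∈ C → v d ∈ C → c ≡ d
  anchors-separated C∈P vc∈C vd∈C = point-injective (trans (unique (x∈p∩q⁺ (point-∈ _ , vc∈C)))
                                                         (sym (unique (x∈p∩q⁺ (point-∈ _ , vd∈C)))))
    where unique = proj₂ (proj₂ (meets-once e₀∈H C∈P))

  labelled-block : ∀ i → Σ (Fin r) λ c → v c ∈ block i
  labelled-block i =
    let (a , a∈ , _) = meets-once e₀∈H (block∈P i)
        (a∈e₀ , a∈block) = x∈p∩q⁻ e₀ _ a∈
        (c , vc≡a) = point-onto a∈e₀
    in c , subst (_∈ block i) (sym vc≡a) a∈block

  colour : Fin n → Fin r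
  colour i = proj₁ (labelled-block i)

  anchor∈block : ∀ i → v (colour i) ∈ block i
  anchor∈block i = proj₂ (labelled-block i)

  colour-anchored : Anchored v colour
  colour-anchored c = anchors-separated (block∈P (v c)) (anchor∈block (v c)) (∈-block (v c))

  ∈-block⁻ : ∀ {i j} → j ∈ block i → colour j ≡ colour i
  ∈-block⁻ {i} {j} j∈ = anchors-separated (block∈P i)
    (subst (v (colour j) ∈_) (block-unique (block∈P i) j∈) (anchor∈block j)) (anchor∈block i)

  ∈-block⁺ : ∀ {i j} → colour j ≡ colour i → j ∈ block i
  ∈-block⁺ {i} {j} eq = subst (j ∈_) same-block (∈-block j)
    where
    same-block : block j ≡ block i
    same-block = disjoint _ _ _ (block∈P j) (block∈P i)
                   (subst (λ c → v c ∈ block j) eq (anchor∈block j)) (anchor∈block i)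

  block≡fibre : ∀ i → block i ≡ fibre colour (colour i)
  block≡fibre i = ⊆-antisym (λ j∈ → ∈-fibre⁺ colour (∈-block⁻ j∈))
                            (λ j∈ → ∈-block⁺ (∈-fibre⁻ colour j∈))

  colour-transversal : ∀ {e} → e List.∈ edges H → Transversal colour e
  colour-transversal {e} e∈H = record { hit = hit ; injective = injective }
    where
    hit : ∀ c → ∃ λ i → i ∈ e × colour i ≡ c
    hit c = let (i , i∈ , _) = meets-once e∈H (block∈P (v c)) ; (i∈e , i∈block) = x∈p∩q⁻ e _ i∈ in
      i , i∈e , trans (∈-block⁻ i∈block) (colour-anchored c)
    injective : ∀ {i j} → i ∈ e → j ∈ e → colour i ≡ colour j → i ≡ j
    injective {i} {j} i∈e j∈e eq =
      trans (unique (x∈p∩q⁺ (i∈e , ∈-block i))) (sym (unique (x∈p∩q⁺ (j∈e , ∈-block⁺ (sym eq)))))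
      where unique = proj₂ (proj₂ (meets-once e∈H (block∈P i)))

module _ (H : Hypergraph n) {e₀ : Subset n} (e₀∈H : e₀ List.∈ edges H) (E : Enumeration e₀ r) where

  colouring : ∀ {P} → IsRPartition H P → Fin n → Fin r
  colouring {P} = PartitionColouring.colour H e₀∈H E {P}

  colouring-⊆ : ∀ {P Q} (p : IsRPartition H P) (q : IsRPartition H Q) → colouring p ≗ colouring q →
                ∀ {C} → C List.∈ P → C List.∈ Q
  colouring-⊆ {P} {Q} p q p≗q {C} C∈P = subst (List._∈ Q) (sym C≡Q-block) (Q.block∈P i)
    where
    module P = PartitionColouring H e₀∈H E {P} p
    module Q = PartitionColouring H e₀∈H E {Q} q
    i = proj₁ (proj₁ (proj₁ p) C C∈P)
    C≡Q-block : C ≡ Q.block i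
    C≡Q-block = begin
      C                                    ≡⟨ P.block-unique C∈P (proj₂ (proj₁ (proj₁ p) C C∈P)) ⟨
      P.block i                            ≡⟨ P.block≡fibre i ⟩
      fibre (colouring p) (colouring p i)  ≡⟨ cong (fibre (colouring p)) (p≗q i) ⟩
      fibre (colouring p) (colouring q i)  ≡⟨ fibre-cong p≗q ⟩
      fibre (colouring q) (colouring q i)  ≡⟨ Q.block≡fibre i ⟨
      Q.block i                            ∎
      where open ≡-Reasoning

  colouring-injective : ∀ {P Q} (p : IsRPartition H P) (q : IsRPartition H Q) →
                        colouring p ≗ colouring q → SamePartition P Q
  colouring-injective p q p≗q C = mk⇔ (colouring-⊆ p q p≗q) (colouring-⊆ q p (sym ∘ p≗q))

-- Identifying two vertices

≗-punchIn : ∀ {x : Fin (suc n)} {f g : Fin (suc n) → Fin r} →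
            f x ≡ g x → f ∘ punchIn x ≗ g ∘ punchIn x → f ≗ g
≗-punchIn {x = x} {f} {g} fx≡gx f≗g j with x ≟ᶠ j
... | yes refl = fx≡gx
... | no x≢j = subst (λ k → f k ≡ g k) (punchIn-punchOut x≢j) (f≗g (punchOut x≢j))

anchored-punchIn : ∀ {x : Fin (suc n)} {v : Fin r → Fin (suc n)} {χ} (x∉v : ∀ c → x ≢ v c) →
                   Anchored v χ → Anchored (λ c → punchOut (x∉v c)) (χ ∘ punchIn x)
anchored-punchIn {χ = χ} x∉v anchored c = trans (cong χ (punchIn-punchOut (x∉v c))) (anchored c)

module Contraction {x y : Fin (suc n)} (x≢y : x ≢ y) where

  w : Fin n
  w = punchOut x≢y

  punchIn-w : punchIn x w ≡ y
  punchIn-w = punchIn-punchOut x≢y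

  -- x is deleted and y, renumbered w, inherits its membership.
  InContraction : Subset (suc n) → Fin n → Set
  InContraction e i = punchIn x i ∈ e ⊎ (i ≡ w × x ∈ e)

  inContraction? : ∀ e → Decidable (InContraction e)
  inContraction? e i = (punchIn x i ∈? e) ⊎-dec ((i ≟ᶠ w) ×-dec (x ∈? e))

  contract : Subset (suc n) → Subset n
  contract e = fromDec (inContraction? e)

  module _ {e : Subset (suc n)} where

    ∈-contract⁺ˡ : ∀ {i} → punchIn x i ∈ e → i ∈ contract e
    ∈-contract⁺ˡ = ∈-fromDec⁺ (inContraction? e) ∘ inj₁

    ∈-contract⁺ʳ : x ∈ e → w ∈ contract e
    ∈-contract⁺ʳ x∈e = ∈-fromDec⁺ (inContraction? e) (inj₂ (refl , x∈e))

    ∈-contract⁻ : ∀ {i} → i ∈ contract e → InContraction e i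
    ∈-contract⁻ = ∈-fromDec⁻ (inContraction? e)

    w∈contract⁻ : w ∈ contract e → y ∈ e ⊎ x ∈ e
    w∈contract⁻ w∈ with ∈-contract⁻ w∈
    ... | inj₁ y∈e = inj₁ (subst (_∈ e) punchIn-w y∈e)
    ... | inj₂ (_ , x∈e) = inj₂ x∈e

  contract-transversal : ∀ {χ : Fin (suc n) → Fin r} {e} → χ x ≡ χ y → Transversal χ e →
                         Transversal (χ ∘ punchIn x) (contract e)
  contract-transversal {χ = χ} {e} χx≡χy T = record { hit = hit′ ; injective = injective′ }
    where
    open Transversal T
    χw≡χx : χ (punchIn x w) ≡ χ x
    χw≡χx = trans (cong χ punchIn-w) (sym χx≡χy)
    hit′ : ∀ c → ∃ λ i → i ∈ contract e × χ (punchIn x i) ≡ c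
    hit′ c with hit c
    ... | i , i∈e , χi≡c with x ≟ᶠ i
    ...   | yes refl = w , ∈-contract⁺ʳ i∈e , trans χw≡χx χi≡c
    ...   | no x≢i = punchOut x≢i , ∈-contract⁺ˡ (subst (_∈ e) (sym (punchIn-punchOut x≢i)) i∈e)
                   , trans (cong χ (punchIn-punchOut x≢i)) χi≡c
    injective′ : ∀ {i j} → i ∈ contract e → j ∈ contract e → χ (punchIn x i) ≡ χ (punchIn x j) → i ≡ j
    injective′ i∈ j∈ eq with ∈-contract⁻ i∈ | ∈-contract⁻ j∈
    ... | inj₁ i∈e       | inj₁ j∈e       = punchIn-injective x _ _ (injective i∈e j∈e eq)
    ... | inj₂ (refl , _) | inj₂ (refl , _) = refl
    ... | inj₁ i∈e       | inj₂ (refl , x∈e) =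
      contradiction (injective i∈e x∈e (trans eq χw≡χx)) (punchInᵢ≢i x _)
    ... | inj₂ (refl , x∈e) | inj₁ j∈e =
      contradiction (injective j∈e x∈e (trans (sym eq) χw≡χx)) (punchInᵢ≢i x _)

  contract-≡⇒agree : ∀ {a b j} → contract a ≡ contract b → j ≢ x → j ≢ y → j ∈ a → j ∈ b
  contract-≡⇒agree {a} {b} {j} eq j≢x j≢y j∈a =
    [ subst (_∈ b) (punchIn-punchOut x≢j)
    , (λ (i≡w , _) → contradiction
          (trans (sym (punchIn-punchOut x≢j)) (trans (cong (punchIn x) i≡w) punchIn-w)) j≢y)
    ]′ (∈-contract⁻ i∈contract-b)
    where
    x≢j : x ≢ j
    x≢j = j≢x ∘ sym
    i∈contract-b : punchOut x≢j ∈ contract b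
    i∈contract-b = subst (punchOut x≢j ∈_) eq (∈-contract⁺ˡ (subst (_∈ a) (sym (punchIn-punchOut x≢j)) j∈a))

  -- Off {x, y}, a ⊆ b; as y ∉ a, the point of colour χ y in a can only be x.
  transversal-forces : ∀ {χ : Fin (suc n) → Fin r} {a b} → Transversal χ a → Transversal χ b →
                       y ∉ a → y ∈ b → (∀ {j} → j ≢ x → j ≢ y → j ∈ a → j ∈ b) → χ x ≡ χ y
  transversal-forces {χ = χ} Ta Tb y∉a y∈b agree with Transversal.hit Ta (χ y)
  ... | i , i∈a , χi≡χy with i ≟ᶠ x
  ...   | yes refl = χi≡χy
  ...   | no i≢x = contradiction (Transversal.injective Tb (agree i≢x i≢y i∈a) y∈b χi≡χy) i≢y
    where
    i≢y : i ≢ y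
    i≢y refl = y∉a i∈a

  -- χ₀ keeps x and y apart in every edge; χ₁, χ₂ stop an edge through x collapsing onto one through y.
  module _ {χ₀ χ₁ χ₂ : Fin (suc n) → Fin r}
           (χ₀x≡χ₀y : χ₀ x ≡ χ₀ y) (χ₁y≡χ₂y : χ₁ y ≡ χ₂ y) (χ₁x≢χ₂x : χ₁ x ≢ χ₂ x) where

    Transversal₀₁₂ : Subset (suc n) → Set
    Transversal₀₁₂ e = Transversal χ₀ e × Transversal χ₁ e × Transversal χ₂ e

    x∈⇒y∉ : ∀ {e} → Transversal₀₁₂ e → x ∈ e → y ∉ e
    x∈⇒y∉ (T₀ , _) x∈e y∈e = x≢y (Transversal.injective T₀ x∈e y∈e χ₀x≡χ₀y)

    no-swap : ∀ {a b} → Transversal₀₁₂ a → Transversal₀₁₂ b → contract a ≡ contract b → y ∉ a → y ∈ b → ⊥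
    no-swap {a} {b} (_ , T₁a , T₂a) (_ , T₁b , T₂b) eq y∉a y∈b = χ₁x≢χ₂x (begin
      χ₁ x ≡⟨ transversal-forces T₁a T₁b y∉a y∈b agree ⟩
      χ₁ y ≡⟨ χ₁y≡χ₂y ⟩
      χ₂ y ≡⟨ transversal-forces T₂a T₂b y∉a y∈b agree ⟨
      χ₂ x ∎)
      where
      open ≡-Reasoning
      agree : ∀ {j} → j ≢ x → j ≢ y → j ∈ a → j ∈ b
      agree = contract-≡⇒agree eq

    contract-≡⇒⊆ : ∀ {a b} → Transversal₀₁₂ a → Transversal₀₁₂ b → contract a ≡ contract b → a ⊆ b
    contract-≡⇒⊆ {a} {b} Ta Tb eq {j} j∈a with j ≟ᶠ x | j ≟ᶠ y
    ... | yes refl | _ = [ ⊥-elim ∘ no-swap Ta Tb eq (x∈⇒y∉ Ta j∈a) , id ]′ w∈contract-b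
      where w∈contract-b = w∈contract⁻ (subst (w ∈_) eq (∈-contract⁺ʳ j∈a))
    ... | no _ | yes refl =
      [ id , (λ x∈b → ⊥-elim (no-swap Tb Ta (sym eq) (x∈⇒y∉ Tb x∈b) j∈a)) ]′ w∈contract-b
      where w∈contract-b = w∈contract⁻ (subst (w ∈_) eq (∈-contract⁺ˡ (subst (_∈ a) (sym punchIn-w) j∈a)))
    ... | no j≢x | no j≢y = contract-≡⇒agree eq j≢x j≢y j∈a

    contract-injective : ∀ {a b} → Transversal₀₁₂ a → Transversal₀₁₂ b → contract a ≡ contract b → a ≡ b
    contract-injective Ta Tb eq = ⊆-antisym (contract-≡⇒⊆ Ta Tb eq) (contract-≡⇒⊆ Tb Ta (sym eq))

admissible-punchIn : ∀ {x : Fin (suc n)} {v : Fin r → Fin (suc n)} {es χ c} (x∉v : ∀ d → x ≢ v d) →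
                     χ x ≡ c → Admissible v es χ →
                     Admissible (λ d → punchOut (x∉v d)) (map (Contraction.contract (x∉v c)) es) (χ ∘ punchIn x)
admissible-punchIn {χ = χ} {c} x∉v χx≡c (anchored , transversals) =
  anchored-punchIn {χ = χ} x∉v anchored ,
  All.map⁺ (All.map (contract-transversal (trans χx≡c (sym (anchored c)))) transversals)
  where open Contraction (x∉v c)

-- Iterated contraction

separating-point : ∀ {χs : List (Fin n → Fin r)} → AllPairs (λ χ ψ → ¬ χ ≗ ψ) χs → 2 ≤ length χs →
                   ∃ λ χ₁ → ∃ λ χ₂ → χ₁ List.∈ χs × χ₂ List.∈ χs × ∃ λ x → χ₁ x ≢ χ₂ x
separating-point {χs = _ ∷ []} _ (s≤s ())
separating-point {χs = χ₁ ∷ χ₂ ∷ _} ((χ₁≉χ₂ ∷ _) ∷ _) _ =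
  χ₁ , χ₂ , Any.here refl , Any.there (Any.here refl) , ¬∀⟶∃¬ _ _ (λ x → χ₁ x ≟ᶠ χ₂ x) χ₁≉χ₂

record Configuration (r q n : ℕ) : Set where
  field
    hyperedges          : List (Subset n)
    hyperedges-distinct : Unique hyperedges
    #hyperedges         : length hyperedges ≡ q
    anchor              : Fin r → Fin n
    colourings          : List (Fin n → Fin r)
    admissible          : All (Admissible anchor hyperedges) colourings
    colourings-distinct : AllPairs (λ χ ψ → ¬ χ ≗ ψ) colourings

  #colourings : ℕ
  #colourings = length colourings

open Configuration

contract-separated : ∀ {q m} (C : Configuration r q (suc n)) {χ₁ χ₂} →
                     χ₁ List.∈ colourings C → χ₂ List.∈ colourings C → ∀ {x} → χ₁ x ≢ χ₂ x →
                     r * m < #colourings C → Σ (Configuration r q n) λ C′ → m < #colourings C′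
contract-separated {r} {n} {q} {m} C {χ₁} {χ₂} χ₁∈ χ₂∈ {x} χ₁x≢χ₂x r*m<#χs =
  C′ , subst (m <_) (sym (length-map (_∘ punchIn x) K)) m<#K
  where
  adm₁ = All.lookup (admissible C) χ₁∈
  adm₂ = All.lookup (admissible C) χ₂∈

  x∉anchor : ∀ d → x ≢ anchor C d
  x∉anchor d x≡vd = χ₁x≢χ₂x (begin
    χ₁ x            ≡⟨ cong χ₁ x≡vd ⟩
    χ₁ (anchor C d) ≡⟨ proj₁ adm₁ d ⟩
    d               ≡⟨ proj₁ adm₂ d ⟨
    χ₂ (anchor C d) ≡⟨ cong χ₂ x≡vd ⟨
    χ₂ x            ∎)
    where open ≡-Reasoning

  crowded = pigeonhole-class (λ χ → χ x) (colourings C) r*m<#χs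
  c = proj₁ crowded
  K = class (λ χ → χ x) c (colourings C)
  m<#K : m < length K
  m<#K = proj₂ crowded
  K-at-x : All (λ χ → χ x ≡ c) K
  K-at-x = All.all-filter (λ χ → χ x ≟ᶠ c) (colourings C)
  K-admissible : All (Admissible (anchor C) (hyperedges C)) K
  K-admissible = All.filter⁺ (λ χ → χ x ≟ᶠ c) (admissible C)

  y = anchor C c
  open Contraction (x∉anchor c)

  χ₀∈K = 0<length⇒∈ {xs = K} (≤-trans (s≤s z≤n) m<#K)
  χ₀ = proj₁ χ₀∈K
  adm₀ = All.lookup K-admissible (proj₂ χ₀∈K)

  χ₀x≡χ₀y : χ₀ x ≡ χ₀ y
  χ₀x≡χ₀y = trans (All.lookup K-at-x (proj₂ χ₀∈K)) (sym (proj₁ adm₀ c))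
  χ₁y≡χ₂y : χ₁ y ≡ χ₂ y
  χ₁y≡χ₂y = trans (proj₁ adm₁ c) (sym (proj₁ adm₂ c))

  transversal₀₁₂ : All (Transversal₀₁₂ χ₀x≡χ₀y χ₁y≡χ₂y χ₁x≢χ₂x) (hyperedges C)
  transversal₀₁₂ = All.zip (proj₂ adm₀ , All.zip (proj₂ adm₁ , proj₂ adm₂))

  C′ : Configuration r q n
  C′ = record
    { hyperedges          = map contract (hyperedges C)
    ; hyperedges-distinct = AllPairs-map⁺-within
        (λ Ta Tb a≢b → a≢b ∘ contract-injective χ₀x≡χ₀y χ₁y≡χ₂y χ₁x≢χ₂x Ta Tb)
        transversal₀₁₂ (hyperedges-distinct C)
    ; #hyperedges         = trans (length-map contract (hyperedges C)) (#hyperedges C)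
    ; anchor              = λ d → punchOut (x∉anchor d)
    ; colourings          = map (_∘ punchIn x) K
    ; admissible          = All.map⁺ (All.zipWith (λ (χx≡c , adm) → admissible-punchIn x∉anchor χx≡c adm)
                                                  (K-at-x , K-admissible))
    ; colourings-distinct = AllPairs-map⁺-within
        (λ χx≡c ψx≡c χ≉ψ → χ≉ψ ∘ ≗-punchIn (trans χx≡c (sym ψx≡c)))
        K-at-x (AllPairs.filter⁺ (λ χ → χ x ≟ᶠ c) (colourings-distinct C))
    }

contract-step : ∀ {q m} (C : Configuration r q (suc n)) → 2 ≤ #colourings C → r * m < #colourings C →
                Σ (Configuration r q n) λ C′ → m < #colourings C′
contract-step C 2≤#χs r*m<#χs =
  let (_ , _ , χ₁∈ , χ₂∈ , _ , χ₁x≢χ₂x) = separating-point (colourings-distinct C) 2≤#χs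
  in contract-separated C χ₁∈ χ₂∈ χ₁x≢χ₂x r*m<#χs

RPartiteHypergraph : (r q n : ℕ) → Set
RPartiteHypergraph r q n = Σ (Hypergraph n) (λ H′ → IsUniform r H′ × numEdges H′ ≡ q × IsRPartite H′)

module _ {q : ℕ} (r≥1 : r ≥ 1) where

  private
    c₀ : Fin r
    c₀ = fromℕ< r≥1

  iterate-contraction : ∀ {n} j (C : Configuration r q n) → r ^ j < #colourings C →
                        Σ (Configuration r q (n ∸ suc j)) λ C′ → 0 < #colourings C′
  iterate-contraction {zero} j C _ with () ← anchor C c₀
  iterate-contraction {suc n} zero C 1<#χs =
    contract-step C 1<#χs (subst (_< #colourings C) (sym (*-zeroʳ r)) (≤-trans (s≤s z≤n) 1<#χs))
  iterate-contraction {suc n} (suc j) C r^[1+j]<#χs =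
    let 2≤#χs = ≤-trans (s≤s (m^n>0 r ⦃ >-nonZero r≥1 ⦄ (suc j))) r^[1+j]<#χs
        (C′ , r^j<#χs′) = contract-step C 2≤#χs r^[1+j]<#χs
    in iterate-contraction j C′ r^j<#χs′

  configuration⇒rPartite : (C : Configuration r q n) → 0 < #colourings C → RPartiteHypergraph r q n
  configuration⇒rPartite C 0<#χs =
    H′ , All.map transversal-∣e∣≡r transversals , #hyperedges C ,
    fibres χ , fibres-isRPartition χ surjective H′ transversals
    where
    χ∈ = 0<length⇒∈ {xs = colourings C} 0<#χs
    χ = proj₁ χ∈
    anchored = proj₁ (All.lookup (admissible C) (proj₂ χ∈))
    transversals = proj₂ (All.lookup (admissible C) (proj₂ χ∈))
    surjective : ∀ c → ∃ λ i → χ i ≡ c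
    surjective c = anchor C c , anchored c
    H′ : Hypergraph _
    H′ = record
      { edges    = hyperedges C
      ; distinct = hyperedges-distinct C
      ; nonempty = All.map (λ T → Transversal.point T c₀ , Transversal.point-∈ T c₀) transversals
      }

module _ (H : Hypergraph n) {e₀ : Subset n} (e₀∈H : e₀ List.∈ edges H) (E : Enumeration e₀ r) where

  initial-configuration : ∀ {q Ps} → numEdges H ≡ q → (ps : All (IsRPartition H) Ps) →
                          AllPairs (λ P P′ → ¬ SamePartition P P′) Ps →
                          Σ (Configuration r q n) λ C → #colourings C ≡ length Ps
  initial-configuration #edges ps distinct = C , length-reduce (colouring H e₀∈H E) ps
    where
    C : Configuration _ _ _
    C = record
      { hyperedges          = edges H
      ; hyperedges-distinct = Hypergraph.distinct H
      ; #hyperedges         = #edges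
      ; anchor              = Enumeration.point E
      ; colourings          = All.reduce (colouring H e₀∈H E) ps
      ; admissible          = All-reduce⁺ (colouring H e₀∈H E)
          (λ {P} p → let open PartitionColouring H e₀∈H E {P} p in colour-anchored , All.tabulate colour-transversal)
          ps
      ; colourings-distinct = AllPairs-reduce⁺ (colouring H e₀∈H E)
                                (λ p q P≠Q p≗q → P≠Q (colouring-injective H e₀∈H E p q p≗q)) ps distinct
      }

proposition3p5 : (r l n q : ℕ) → r ≥ 1 → l ≥ 1 → q ≥ 1 →
    (H : Hypergraph n) → IsUniform r H → numEdges H ≡ q →
    HasAtLeastRPartitions (suc (r ^ (l ∸ 1))) H →
    Σ (Hypergraph (n ∸ l)) (λ H′ → IsUniform r H′ × numEdges H′ ≡ q × IsRPartite H′)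
proposition3p5 r zero n q r≥1 () q≥1 H uniform #edges _
proposition3p5 r (suc j) n q r≥1 _ q≥1 H uniform #edges (Ps , #Ps , rPartitions , distinct) =
  configuration⇒rPartite r≥1 (proj₁ final) (proj₂ final)
  where
  e₀∈H = proj₂ (0<length⇒∈ {xs = edges H} (subst (0 <_) (sym #edges) q≥1))
  E = subst (Enumeration _) (All.lookup uniform e₀∈H) (enumeration _)
  initial = initial-configuration H e₀∈H E #edges rPartitions distinct
  r^j<#colourings = subst (r ^ j <_) (sym (trans (proj₂ initial) #Ps)) ≤-refl
  final = iterate-contraction r≥1 j (proj₁ initial) r^j<#colourings
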